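{- For every pair of positive integers $m,n$ such that $m$ is divisible by $n$ and $m \le n(n-1)$, there exists an Eulerian digraph $G$ with $n$ vertices and $m$ arcs such that $\beta(G) = \frac{m^2}{2n^2} + \frac{m}{2n}$.
   Context: All digraphs are finite and simple: no loops and no multiple arcs, but two arcs in opposite directions between the same pair of vertices are allowed. A digraph is Eulerian if every vertex has in-degree equal to its out-degree. A feedback arc set of a digraph is a set of arcs whose removal leaves a digraph with no directed cycle; $\beta(G)$ denotes the minimum size of a feedback arc set of $G$. -}

module Defs where

open import Data.Nat using (ℕ; zero; suc; _+_; _≤_)
open import Data.Bool using (Bool; true; false; _∧_; not; if_then_else_)
open import Data.Fin using (Fin; zero; suc)
open import Data.List using (List; []; _∷_; _++_; [_]; length)
open import Data.List.Relation.Unary.Unique.Propositional using (Unique)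
open import Data.Product using (Σ; ∃; _×_; _,_)
open import Data.Unit using (⊤)
open import Data.Empty using (⊥)
open import Relation.Binary.PropositionalEquality using (_≡_)
open import Relation.Nullary using (¬_)

-- Arc relations on the vertex set Fin n: A i j ≡ true iff (i , j) is an arc.
-- Opposite arcs are allowed; multiple arcs are impossible by construction.
Rel : ℕ → Set
Rel n = Fin n → Fin n → Bool

record Digraph (n : ℕ) : Set where
  constructor mkDigraph
  field
    arc    : Rel n
    noLoop : ∀ i → arc i i ≡ false
open Digraph public

count : ∀ {n} → (Fin n → Bool) → ℕ
count {zero}  f = 0
count {suc n} f = (if f zero then 1 else 0) + count (λ i → f (suc i))

sumF : ∀ {n} → (Fin n → ℕ) → ℕ
sumF {zero}  f = 0
sumF {suc n} f = f zero + sumF (λ i → f (suc i))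

size : ∀ {n} → Rel n → ℕ
size A = sumF (λ i → count (λ j → A i j))

outDeg inDeg : ∀ {n} → Rel n → Fin n → ℕ
outDeg A v = count (λ j → A v j)
inDeg  A v = count (λ i → A i v)

Eulerian : ∀ {n} → Digraph n → Set
Eulerian G = ∀ v → inDeg (arc G) v ≡ outDeg (arc G) v

Chain : ∀ {n} → Rel n → List (Fin n) → Set
Chain A []           = ⊤
Chain A (x ∷ [])     = ⊤
Chain A (x ∷ y ∷ zs) = (A x y ≡ true) × Chain A (y ∷ zs)

DirectedCycle : ∀ {n} → Rel n → Set
DirectedCycle {n} A =
  Σ (Fin n) λ v → Σ (List (Fin n)) λ vs →
    (1 ≤ length vs) × Unique (v ∷ vs) × Chain A (v ∷ vs ++ [ v ])

Acyclic : ∀ {n} → Rel n → Set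
Acyclic A = ¬ DirectedCycle A

remove : ∀ {n} → Rel n → Rel n → Rel n
remove A F i j = A i j ∧ not (F i j)

IsFAS : ∀ {n} → Digraph n → Rel n → Set
IsFAS G F = (∀ i j → F i j ≡ true → arc G i j ≡ true) × Acyclic (remove (arc G) F)

IsBeta : ∀ {n} → Digraph n → ℕ → Set
IsBeta {n} G b =
  (Σ (Rel n) λ F → IsFAS G F × size F ≡ b) ×
  (∀ F → IsFAS G F → b ≤ size F)

module Submission where

-- The circulant digraph on ℤ/n with arcs x → x + 1, …, x + k, where k = m/n < n, is k-regular
-- with kn = m arcs. Its wrapped arcs (those passing from n - 1 to 0) number 1 + 2 + … + k, and
-- removing them leaves only increasing arcs, so they form a feedback arc set. Conversely, if G - F
-- is acyclic, it has a source in every nonempty vertex set; peeling such sources off one by one,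
-- the i-th peeled vertex still has at least k - i + 1 in-arcs from the remaining vertices, and all
-- of them lie in F. Hence β = k(k + 1)/2 = m²/(2n²) + m/(2n).

open import Defs
open import Data.Nat using (ℕ; zero; suc; _+_; _*_; _∸_; _≤_; _<_; z≤n; s≤s; _<ᵇ_; _≤ᵇ_)
open import Data.Nat.Properties hiding (_≟_)
open import Data.Nat.Divisibility using (_∣_; divides)
open import Data.Nat.Tactic.RingSolver using (solve-∀)
import Data.Bool.Properties as Bool
open import Data.Bool using (Bool; true; false; _∧_; _∨_; not; if_then_else_)
open import Data.Bool.Properties using (∧-conicalˡ; ∧-conicalʳ; ∧-zeroʳ; ∧-identityʳ; ∧-comm; ∧-inverseʳ; ∨-zeroʳ; ¬-not; T-≡)
open import Algebra.Bundles using (CommutativeMonoid)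
open import Algebra.Properties.CommutativeSemigroup (CommutativeMonoid.commutativeSemigroup Bool.∧-commutativeMonoid)
  using (xy∙z≈xz∙y)
open import Data.Fin using (Fin; zero; suc; toℕ)
open import Data.Fin.Properties using (_≟_; toℕ<n; any?)
open import Data.Product using (Σ; _×_; _,_; proj₂)
open import Data.Sum using (_⊎_; inj₁; inj₂)
open import Data.List using (List; []; _∷_; _++_; [_]; length)
open import Data.List.Relation.Unary.All as All using (All; []; _∷_)
open import Data.List.Relation.Unary.AllPairs using ([]; _∷_)
open import Data.List.Relation.Unary.Unique.Propositional using (Unique)
open import Data.List.Relation.Unary.Any using (here; there)
open import Data.List.Relation.Binary.Subset.Propositional using (_⊆_)
open import Data.List.Relation.Unary.All.Properties using (¬Any⇒All¬)
open import Data.Empty using (⊥; ⊥-elim)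
open import Function using (_∘_)
open import Function.Bundles using (Equivalence)
open import Relation.Nullary using (does; yes; no)
open import Relation.Nullary.Decidable using (dec-true)
open import Relation.Binary.PropositionalEquality hiding ([_])

indicator : Bool → ℕ
indicator b = if b then 1 else 0

indicator≤1 : ∀ b → indicator b ≤ 1
indicator≤1 true  = ≤-refl
indicator≤1 false = z≤n

count-cong : ∀ {n} {f g : Fin n → Bool} → (∀ i → f i ≡ g i) → count f ≡ count g
count-cong {zero}  f≗g = refl
count-cong {suc n} f≗g = cong₂ _+_ (cong indicator (f≗g zero)) (count-cong (f≗g ∘ suc))

count-mono : ∀ {n} {f g : Fin n → Bool} → (∀ i → f i ≡ true → g i ≡ true) → count f ≤ count g
count-mono {zero}          f⇒g = z≤n
count-mono {suc n} {f} {g} f⇒g = +-mono-≤ (indicator-mono (f zero) (g zero) (f⇒g zero)) (count-mono (f⇒g ∘ suc))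
  where
  indicator-mono : ∀ a b → (a ≡ true → b ≡ true) → indicator a ≤ indicator b
  indicator-mono false b     _   = z≤n
  indicator-mono true  b a⇒b rewrite a⇒b refl = ≤-refl

count-false : ∀ n → count {n} (λ _ → false) ≡ 0
count-false zero    = refl
count-false (suc n) = count-false n

count-true : ∀ n → count {n} (λ _ → true) ≡ n
count-true zero    = refl
count-true (suc n) = cong suc (count-true n)

count≤n : ∀ {n} (f : Fin n → Bool) → count f ≤ n
count≤n {n} f = subst (count f ≤_) (count-true n) (count-mono {n} {f} {λ _ → true} (λ _ _ → refl))

count-witness : ∀ {n} (f : Fin n → Bool) → 0 < count f → Σ (Fin n) λ i → f i ≡ true
count-witness {suc n} f 0<c with f zero in f0
... | true  = zero , f0
... | false = let i , fi = count-witness (f ∘ suc) 0<c in suc i , fi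

count-∨ : ∀ {n} (f g : Fin n → Bool) → (∀ i → f i ≡ true → g i ≡ true → ⊥) →
  count (λ i → f i ∨ g i) ≡ count f + count g
count-∨ {zero}  f g disjoint = refl
count-∨ {suc n} f g disjoint with f zero in f0 | g zero in g0
... | true  | true  = ⊥-elim (disjoint zero f0 g0)
... | true  | false = cong suc (count-∨ (f ∘ suc) (g ∘ suc) (disjoint ∘ suc))
... | false | true  = trans (cong suc (count-∨ (f ∘ suc) (g ∘ suc) (disjoint ∘ suc))) (sym (+-suc _ _))
... | false | false = count-∨ (f ∘ suc) (g ∘ suc) (disjoint ∘ suc)

_─_ : ∀ {n} → (Fin n → Bool) → Fin n → Fin n → Bool
(f ─ v) w = f w ∧ not (does (w ≟ v))

count-─ : ∀ {n} (f : Fin n → Bool) v → count f ≡ count (f ─ v) + indicator (f v)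
count-─ {suc n} f zero rewrite ∧-zeroʳ (f zero) =
  trans (+-comm (indicator (f zero)) _) (cong (_+ indicator (f zero)) (count-cong (λ i → sym (∧-identityʳ (f (suc i))))))
count-─ {suc n} f (suc v) rewrite ∧-identityʳ (f zero) =
  trans (cong (indicator (f zero) +_) (count-─ (f ∘ suc) v)) (sym (+-assoc (indicator (f zero)) _ _))

count-≤-suc-─ : ∀ {n} (f : Fin n → Bool) v → count f ≤ suc (count (f ─ v))
count-≤-suc-─ f v = ≤-trans (≤-reflexive (count-─ f v))
  (subst (count (f ─ v) + indicator (f v) ≤_) (+-comm (count (f ─ v)) 1) (+-monoʳ-≤ (count (f ─ v)) (indicator≤1 (f v))))

sumF-cong : ∀ {n} {f g : Fin n → ℕ} → (∀ i → f i ≡ g i) → sumF f ≡ sumF g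
sumF-cong {zero}  f≗g = refl
sumF-cong {suc n} f≗g = cong₂ _+_ (f≗g zero) (sumF-cong (f≗g ∘ suc))

sumF-mono : ∀ {n} {f g : Fin n → ℕ} → (∀ i → f i ≤ g i) → sumF f ≤ sumF g
sumF-mono {zero}  f≤g = z≤n
sumF-mono {suc n} f≤g = +-mono-≤ (f≤g zero) (sumF-mono (f≤g ∘ suc))

sumF-+ : ∀ {n} (f g : Fin n → ℕ) → sumF (λ i → f i + g i) ≡ sumF f + sumF g
sumF-+ {zero}  f g = refl
sumF-+ {suc n} f g = trans (cong (f zero + g zero +_) (sumF-+ (f ∘ suc) (g ∘ suc)))
  (+-interchange (f zero) (g zero) _ _)
  where
  +-interchange : ∀ a b c d → a + b + (c + d) ≡ a + c + (b + d)
  +-interchange = solve-∀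

sumF-indicator : ∀ {n} (f : Fin n → Bool) → sumF (λ i → indicator (f i)) ≡ count f
sumF-indicator {zero}  f = refl
sumF-indicator {suc n} f = cong (indicator (f zero) +_) (sumF-indicator (f ∘ suc))

sumF-const : ∀ n c → sumF {n} (λ _ → c) ≡ n * c
sumF-const zero    c = refl
sumF-const (suc n) c = cong (c +_) (sumF-const n c)

size-mono : ∀ {n} {R Q : Rel n} → (∀ u w → R u w ≡ true → Q u w ≡ true) → size R ≤ size Q
size-mono R⇒Q = sumF-mono (λ u → count-mono (R⇒Q u))

size-─-column : ∀ {n} (R : Rel n) v → size R ≡ inDeg R v + size (λ u → R u ─ v)
size-─-column R v = begin
  size R                                                  ≡⟨ sumF-cong (λ u → count-─ (R u) v) ⟩
  sumF (λ u → count (R u ─ v) + indicator (R u v))        ≡⟨ sumF-+ (λ u → count (R u ─ v)) (λ u → indicator (R u v)) ⟩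
  size (λ u → R u ─ v) + sumF (λ u → indicator (R u v))   ≡⟨ cong (size (λ u → R u ─ v) +_) (sumF-indicator (λ u → R u v)) ⟩
  size (λ u → R u ─ v) + inDeg R v                        ≡⟨ +-comm _ (inDeg R v) ⟩
  inDeg R v + size (λ u → R u ─ v)                        ∎
  where open ≡-Reasoning

countBelow : ℕ → (ℕ → Bool) → ℕ
countBelow n f = count {n} (λ i → f (toℕ i))

sumBelow : ℕ → (ℕ → ℕ) → ℕ
sumBelow n f = sumF {n} (λ i → f (toℕ i))

countBelow-+ : ∀ m n f → countBelow (m + n) f ≡ countBelow m f + countBelow n (λ z → f (m + z))
countBelow-+ zero    n f = refl
countBelow-+ (suc m) n f =
  trans (cong (indicator (f 0) +_) (countBelow-+ m n (f ∘ suc))) (sym (+-assoc (indicator (f 0)) _ _))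

between : ℕ → ℕ → ℕ → Bool
between a b z = (a ≤ᵇ z) ∧ (z <ᵇ b)

between-suc : ∀ a b z → between (suc a) (suc b) (suc z) ≡ between a b z
between-suc zero    b z = refl
between-suc (suc a) b z = refl

between-+ : ∀ c a b z → between (c + a) (c + b) (c + z) ≡ between a b z
between-+ zero    a b z = refl
between-+ (suc c) a b z = trans (between-suc (c + a) (c + b) (c + z)) (between-+ c a b z)

countBelow-between : ∀ n a b → b ≤ n → countBelow n (between a b) ≡ b ∸ a
countBelow-between zero    a       .zero    z≤n      = sym (0∸n≡0 a)
countBelow-between (suc n) a       zero     _        =
  trans (count-cong {suc n} (λ i → ∧-zeroʳ (a ≤ᵇ toℕ i))) (trans (count-false (suc n)) (sym (0∸n≡0 a)))
countBelow-between (suc n) zero    (suc b)  (s≤s b≤n) = cong suc (countBelow-between n zero b b≤n)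
countBelow-between (suc n) (suc a) (suc b)  (s≤s b≤n) =
  trans (count-cong {n} (λ i → between-suc a b (toℕ i))) (countBelow-between n a b b≤n)

+-<ᵇ : ∀ c y d → (c + y <ᵇ d) ≡ (y <ᵇ d ∸ c)
+-<ᵇ zero    y d       = refl
+-<ᵇ (suc c) y zero    = refl
+-<ᵇ (suc c) y (suc d) = +-<ᵇ c y d

<ᵇ-suc-+ : ∀ t x k → (t <ᵇ suc (x + k)) ≡ (t ∸ k ≤ᵇ x)
<ᵇ-suc-+ zero    x zero    = refl
<ᵇ-suc-+ (suc t) x zero    rewrite +-identityʳ x = refl
<ᵇ-suc-+ zero    x (suc k) = refl
<ᵇ-suc-+ (suc t) x (suc k) rewrite +-suc x k = <ᵇ-suc-+ t x k

triangle : ℕ → ℕ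
triangle zero    = 0
triangle (suc j) = suc j + triangle j

double-triangle : ∀ j → 2 * triangle j ≡ j * suc j
double-triangle zero    = refl
double-triangle (suc j) = begin
  2 * (suc j + triangle j)       ≡⟨ *-distribˡ-+ 2 (suc j) (triangle j) ⟩
  2 * suc j + 2 * triangle j     ≡⟨ cong (2 * suc j +_) (double-triangle j) ⟩
  2 * suc j + j * suc j          ≡⟨ *-distribʳ-+ (suc j) 2 j ⟨
  suc (suc j) * suc j            ≡⟨ *-comm (suc (suc j)) (suc j) ⟩
  suc j * suc (suc j)            ∎
  where open ≡-Reasoning

sumBelow-suc : ∀ n f → sumBelow n (λ x → suc (f x)) ≡ n + sumBelow n f
sumBelow-suc n f =
  trans (sumF-+ {n} (λ _ → 1) (λ i → f (toℕ i))) (cong (_+ sumBelow n f) (trans (sumF-const n 1) (*-identityʳ n)))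

sumBelow-id : ∀ k → sumBelow (suc k) (λ x → x) ≡ triangle k
sumBelow-id zero    = refl
sumBelow-id (suc k) = trans (sumBelow-suc (suc k) (λ x → x)) (cong (suc k +_) (sumBelow-id k))

sumBelow-∸ : ∀ p r → sumBelow (p + r) (λ x → x ∸ p) ≡ sumBelow r (λ x → x)
sumBelow-∸ zero    r = refl
sumBelow-∸ (suc p) r = sumBelow-∸ p r

sumBelow-overflow : ∀ p k → sumBelow (p + suc k) (λ x → suc x + k ∸ (p + suc k)) ≡ triangle k
sumBelow-overflow p k = begin
  sumBelow (p + suc k) (λ x → suc x + k ∸ (p + suc k)) ≡⟨ sumF-cong {p + suc k} (λ i → overflow (toℕ i)) ⟩
  sumBelow (p + suc k) (λ x → x ∸ p)                   ≡⟨ sumBelow-∸ p (suc k) ⟩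
  sumBelow (suc k) (λ x → x)                           ≡⟨ sumBelow-id k ⟩
  triangle k                                           ∎
  where
  open ≡-Reasoning
  overflow : ∀ x → suc x + k ∸ (p + suc k) ≡ x ∸ p
  overflow x = trans (cong₂ _∸_ (cong suc (+-comm x k)) (+-comm p (suc k))) ([m+n]∸[m+o]≡n∸o (suc k) x p)

module _ {n : ℕ} where

  open import Data.List.Membership.DecPropositional (_≟_ {n}) using (_∈_; _∈?_)

  count-≟ : ∀ (x : Fin n) → count (λ i → does (i ≟ x)) ≡ 1
  count-≟ x = begin
    count (λ i → does (i ≟ x))                                   ≡⟨ count-─ (λ i → does (i ≟ x)) x ⟩
    count ((λ i → does (i ≟ x)) ─ x) + indicator (does (x ≟ x))  ≡⟨ cong₂ _+_ none-but-x x≟x ⟩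
    0 + 1                                                        ∎
    where
    open ≡-Reasoning
    none-but-x : count ((λ i → does (i ≟ x)) ─ x) ≡ 0
    none-but-x = trans (count-cong (λ i → ∧-inverseʳ (does (i ≟ x)))) (count-false n)
    x≟x : indicator (does (x ≟ x)) ≡ 1
    x≟x = cong indicator (dec-true (x ≟ x) refl)

  count-∈-unique : ∀ xs → Unique xs → count (λ i → does (i ∈? xs)) ≡ length xs
  count-∈-unique []       _            = count-false n
  count-∈-unique (x ∷ xs) (x∉xs ∷ !xs) =
    trans (count-∨ (λ i → does (i ≟ x)) (λ i → does (i ∈? xs)) disjoint)
          (cong₂ _+_ (count-≟ x) (count-∈-unique xs !xs))
    where
    disjoint : ∀ i → does (i ≟ x) ≡ true → does (i ∈? xs) ≡ true → ⊥
    disjoint i i≡x i∈xs with i ≟ x | i ∈? xs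
    ... | yes refl | yes x∈xs = All.lookup x∉xs x∈xs refl

  length≤-unique : ∀ xs → Unique xs → length xs ≤ n
  length≤-unique xs !xs = subst (_≤ n) (count-∈-unique xs !xs) (count≤n _)

  module _ (H : Rel n) (H-irreflexive : ∀ i → H i i ≡ false) (H-acyclic : Acyclic H) (S : Fin n → Bool) where

    SourceIn : Set
    SourceIn = Σ (Fin n) λ v → S v ≡ true × (∀ u → S u ≡ true → H u v ≡ false)

    path-to : ∀ x xs {u} → Chain H (x ∷ xs) → Unique (x ∷ xs) → u ∈ xs →
      Σ (List (Fin n)) λ pre → Chain H (x ∷ pre ++ [ u ]) × Unique (u ∷ x ∷ pre) × pre ⊆ xs
    path-to x (y ∷ ys) (x→y , _) ((x≢y ∷ _) ∷ _) (here refl) =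
      [] , (x→y , _) , (((λ y≡x → x≢y (sym y≡x)) ∷ []) ∷ ([] ∷ [])) , λ ()
    path-to x (y ∷ ys) {u} (x→y , c) (x∉y∷ys ∷ !y∷ys) (there u∈ys)
      with pre , c′ , (u∉y∷pre ∷ !y∷pre) , pre⊆ys ← path-to y ys c !y∷ys u∈ys =
      (y ∷ pre) , (x→y , c′) , (u∉x∷y∷pre ∷ (All.tabulate (All.lookup x∉y∷ys ∘ y∷pre⊆y∷ys) ∷ !y∷pre)) , y∷pre⊆y∷ys
      where
      y∷pre⊆y∷ys : y ∷ pre ⊆ y ∷ ys
      y∷pre⊆y∷ys (here e)  = here e
      y∷pre⊆y∷ys (there p) = there (pre⊆ys p)
      u∉x∷y∷pre : All (u ≢_) (x ∷ y ∷ pre)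
      u∉x∷y∷pre = (λ u≡x → All.lookup x∉y∷ys (there u∈ys) (sym u≡x)) ∷ u∉y∷pre

    -- Walk backwards along H inside S on a simple path: either the current end is a source, or its
    -- predecessor is new (and the path grows, which can happen at most n times), or it closes a cycle.
    source-walk : (fuel : ℕ) (x : Fin n) (xs : List (Fin n)) → S x ≡ true → Chain H (x ∷ xs) →
      Unique (x ∷ xs) → n < length (x ∷ xs) + fuel → SourceIn
    source-walk zero x xs _ _ !x∷xs n<len =
      ⊥-elim (<⇒≱ n<len (subst (_≤ n) (sym (+-identityʳ _)) (length≤-unique (x ∷ xs) !x∷xs)))
    source-walk (suc fuel) x xs Sx c !x∷xs n<len with any? (λ w → (S w ∧ H w x) Bool.≟ true)
    ... | no no-predecessor = x , Sx , λ u Su → ¬-not λ u→x → no-predecessor (u , cong₂ _∧_ Su u→x)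
    ... | yes (w , Sw∧w→x) with w ∈? (x ∷ xs)
    ...   | yes (here refl) with () ← trans (sym (H-irreflexive w)) (∧-conicalʳ _ _ Sw∧w→x)
    ...   | yes (there w∈xs) =
      let pre , c′ , !w∷x∷pre , _ = path-to x xs c !x∷xs w∈xs
      in ⊥-elim (H-acyclic (w , x ∷ pre , s≤s z≤n , !w∷x∷pre , ∧-conicalʳ _ _ Sw∧w→x , c′))
    ...   | no w∉x∷xs =
      source-walk fuel w (x ∷ xs) (∧-conicalˡ _ _ Sw∧w→x) (∧-conicalʳ _ _ Sw∧w→x , c)
        (¬Any⇒All¬ (x ∷ xs) w∉x∷xs ∷ !x∷xs) (subst (n <_) (+-suc _ fuel) n<len)

    source-in : ∀ v → S v ≡ true → SourceIn
    source-in v Sv = source-walk n v [] Sv _ ([] ∷ []) ≤-refl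

restrict : ∀ {n} → (Fin n → Bool) → Rel n → Rel n
restrict S R u w = (S u ∧ S w) ∧ R u w

restrict-─ : ∀ a b c d e → ((a ∧ d) ∧ (b ∧ e)) ∧ c ≡ true → ((a ∧ b) ∧ c) ∧ e ≡ true
restrict-─ true true true true true _ = refl

module _ {n : ℕ} (A F : Rel n) (A-irreflexive : ∀ i → A i i ≡ false) (acyclic : Acyclic (remove A F)) where

  remove-irreflexive : ∀ i → remove A F i i ≡ false
  remove-irreflexive i = cong (_∧ not (F i i)) (A-irreflexive i)

  arc-into-source-removed : ∀ u v → A u v ≡ true → remove A F u v ≡ false → F u v ≡ true
  arc-into-source-removed u v Auv ¬remains = Bool.not-injective (trans (sym (cong (_∧ not (F u v)) Auv)) ¬remains)

  -- A source v of A minus F within S receives at least j arcs from S, all of them in F; recurse on S minus v.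
  triangle≤size-restrict : ∀ j S → j ≤ count S → (∀ v → S v ≡ true → j ≤ count (λ u → S u ∧ A u v)) →
    triangle j ≤ size (restrict S F)
  triangle≤size-restrict zero    S _      _      = z≤n
  triangle≤size-restrict (suc j) S j<|S| indegS
    with v₀ , Sv₀ ← count-witness S (≤-trans (s≤s z≤n) j<|S|)
    with v , Sv , v-source ← source-in (remove A F) remove-irreflexive acyclic S v₀ Sv₀ = begin
    suc j + triangle j                                             ≤⟨ +-mono-≤ F-into-v (triangle≤size-restrict j (S ─ v) j≤|S─v| indeg-S─v) ⟩
    inDeg (restrict S F) v + size (restrict (S ─ v) F)             ≤⟨ +-monoʳ-≤ (inDeg (restrict S F) v) (size-mono restrict-S─v) ⟩
    inDeg (restrict S F) v + size (λ u → restrict S F u ─ v)       ≡⟨ size-─-column (restrict S F) v ⟨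
    size (restrict S F)                                            ∎
    where
    open ≤-Reasoning
    F-into-v : suc j ≤ inDeg (restrict S F) v
    F-into-v = ≤-trans (indegS v Sv) (count-mono λ u SuAuv →
      let Su = ∧-conicalˡ _ _ SuAuv in
      cong₂ _∧_ (cong₂ _∧_ Su Sv) (arc-into-source-removed u v (∧-conicalʳ _ _ SuAuv) (v-source u Su)))

    j≤|S─v| : j ≤ count (S ─ v)
    j≤|S─v| = ≤-pred (≤-trans j<|S| (count-≤-suc-─ S v))

    indeg-S─v : ∀ w → (S ─ v) w ≡ true → j ≤ count (λ u → (S ─ v) u ∧ A u w)
    indeg-S─v w S─v∋w = ≤-pred (begin
      suc j                                          ≤⟨ indegS w (∧-conicalˡ _ _ S─v∋w) ⟩
      count (λ u → S u ∧ A u w)                      ≤⟨ count-≤-suc-─ (λ u → S u ∧ A u w) v ⟩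
      suc (count ((λ u → S u ∧ A u w) ─ v))          ≡⟨ cong suc (count-cong (λ u → xy∙z≈xz∙y (S u) (A u w) _)) ⟩
      suc (count (λ u → (S ─ v) u ∧ A u w))          ∎)

    restrict-S─v : ∀ u w → restrict (S ─ v) F u w ≡ true → (restrict S F u ─ v) w ≡ true
    restrict-S─v u w = restrict-─ (S u) (S w) (F u w) _ _

  triangle≤size-fas : ∀ k → k ≤ n → (∀ v → k ≤ inDeg A v) → triangle k ≤ size F
  triangle≤size-fas k k≤n indeg =
    triangle≤size-restrict k (λ _ → true) (subst (k ≤_) (sym (count-true n)) k≤n) (λ v _ → indeg v)

∨-true : ∀ a b → a ∨ b ≡ true → a ≡ true ⊎ b ≡ true
∨-true true  b     _ = inj₁ refl
∨-true false true  _ = inj₂ refl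

∨-∧-not : ∀ a b → (a ∨ b) ∧ not b ≡ true → a ≡ true
∨-∧-not true  b     _ = refl
∨-∧-not false true  ()
∨-∧-not false false ()

chain⇒< : ∀ {n} {R : Rel n} (h : Fin n → ℕ) → (∀ i j → R i j ≡ true → h i < h j) →
  ∀ x ys z → Chain R (x ∷ ys ++ [ z ]) → h x < h z
chain⇒< h R⇒< x []       z (r , _) = R⇒< x z r
chain⇒< h R⇒< x (y ∷ ys) z (r , c) = <-trans (R⇒< x y r) (chain⇒< h R⇒< y ys z c)

acyclic-if-monotone : ∀ {n} {R : Rel n} (h : Fin n → ℕ) → (∀ i j → R i j ≡ true → h i < h j) → Acyclic R
acyclic-if-monotone h R⇒< (v , vs , _ , _ , c) = <-irrefl refl (chain⇒< h R⇒< v vs v c)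

module Circulant (N k : ℕ) (k<N : k < N) where

  -- window x z holds iff x < z ≤ x + k.  Vertex x has the out-neighbours x + 1, …, x + k
  -- modulo N; the arcs x → y for which x + k reaches y only after passing N are "wrapped".
  window : ℕ → ℕ → Bool
  window x = between (suc x) (suc x + k)

  forward wrapped circulantArc : Rel N
  forward      i j = window (toℕ i) (toℕ j)
  wrapped      i j = window (toℕ i) (N + toℕ j)
  circulantArc i j = forward i j ∨ wrapped i j

  window⇒< : ∀ x z → window x z ≡ true → x < z
  window⇒< x z w = <ᵇ⇒< x z (Equivalence.from T-≡ (∧-conicalˡ (x <ᵇ z) _ w))

  window⇒≤ : ∀ x z → window x z ≡ true → z ≤ x + k
  window⇒≤ x z w = ≤-pred (<ᵇ⇒< z (suc x + k) (Equivalence.from T-≡ (∧-conicalʳ (x <ᵇ z) _ w)))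

  window-+ : ∀ c x z → window (c + x) (c + z) ≡ window x z
  window-+ c x z = trans (cong₂ (λ a b → between a b (c + z)) (sym (+-suc c x)) shifted-end)
                         (between-+ c (suc x) (suc x + k) z)
    where
    shifted-end : suc (c + x) + k ≡ c + (suc x + k)
    shifted-end = trans (cong suc (+-assoc c x k)) (sym (+-suc c (x + k)))

  window≡between : ∀ x t → window x t ≡ between (t ∸ k) t x
  window≡between x t = trans (cong ((x <ᵇ t) ∧_) (<ᵇ-suc-+ t x k)) (∧-comm (x <ᵇ t) _)

  forward-wrapped-disjoint : ∀ i j → forward i j ≡ true → wrapped i j ≡ true → ⊥
  forward-wrapped-disjoint i j f w = <-irrefl refl (begin-strict
    N + y   ≤⟨ window⇒≤ x (N + y) w ⟩
    x + k   <⟨ +-monoˡ-< k (window⇒< x y f) ⟩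
    y + k   <⟨ +-monoʳ-< y k<N ⟩
    y + N   ≡⟨ +-comm y N ⟩
    N + y   ∎)
    where
    open ≤-Reasoning
    x = toℕ i
    y = toℕ j

  circulantArc-irreflexive : ∀ i → circulantArc i i ≡ false
  circulantArc-irreflexive i = ¬-not loop
    where
    x = toℕ i
    loop : circulantArc i i ≡ true → ⊥
    loop a with ∨-true (forward i i) (wrapped i i) a
    ... | inj₁ f = <-irrefl refl (window⇒< x x f)
    ... | inj₂ w = <-irrefl refl (<-≤-trans (+-monoʳ-< x k<N) (subst (_≤ x + k) (+-comm N x) (window⇒≤ x (N + x) w)))

  circulant : Digraph N
  circulant = mkDigraph circulantArc circulantArc-irreflexive

  outDeg-circulant : ∀ i → outDeg circulantArc i ≡ k
  outDeg-circulant i = begin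
    outDeg circulantArc i                                             ≡⟨ count-∨ (forward i) (wrapped i) (forward-wrapped-disjoint i) ⟩
    countBelow N (window x) + countBelow N (λ y → window x (N + y))  ≡⟨ countBelow-+ N N (window x) ⟨
    countBelow (N + N) (window x)                                     ≡⟨ countBelow-between (N + N) (suc x) (suc x + k) end≤2N ⟩
    suc x + k ∸ suc x                                                 ≡⟨ m+n∸m≡n (suc x) k ⟩
    k                                                                 ∎
    where
    open ≡-Reasoning
    x = toℕ i
    end≤2N : suc x + k ≤ N + N
    end≤2N = +-mono-≤ (toℕ<n i) (<⇒≤ k<N)

  -- The in-neighbours of y are the x < N with x < t ≤ x + k for t = y or t = N + y; shifting
  -- the first kind by N turns both into the single interval [t - k, t) below 2N with t = N + y.
  inDeg-circulant : ∀ j → inDeg circulantArc j ≡ k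
  inDeg-circulant j = begin
    inDeg circulantArc j                                                ≡⟨ count-∨ (λ i → forward i j) (λ i → wrapped i j) (λ i → forward-wrapped-disjoint i j) ⟩
    countBelow N (λ x → window x y) + countBelow N (λ x → window x t)   ≡⟨ cong (_+ countBelow N (λ x → window x t)) (count-cong {N} (λ i → sym (window-+ N (toℕ i) y))) ⟩
    countBelow N (λ x → window (N + x) t) + countBelow N (λ x → window x t)   ≡⟨ +-comm _ (countBelow N (λ x → window x t)) ⟩
    countBelow N (λ x → window x t) + countBelow N (λ x → window (N + x) t)   ≡⟨ countBelow-+ N N (λ x → window x t) ⟨
    countBelow (N + N) (λ x → window x t)                               ≡⟨ count-cong {N + N} (λ i → window≡between (toℕ i) t) ⟩
    countBelow (N + N) (between (t ∸ k) t)                              ≡⟨ countBelow-between (N + N) (t ∸ k) t (+-monoʳ-≤ N (<⇒≤ (toℕ<n j))) ⟩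
    t ∸ (t ∸ k)                                                         ≡⟨ m∸[m∸n]≡n (≤-trans (<⇒≤ k<N) (m≤m+n N y)) ⟩
    k                                                                   ∎
    where
    open ≡-Reasoning
    y = toℕ j
    t = N + y

  circulant-eulerian : Eulerian circulant
  circulant-eulerian v = trans (inDeg-circulant v) (sym (outDeg-circulant v))

  size-circulant : size circulantArc ≡ k * N
  size-circulant = trans (sumF-cong outDeg-circulant) (trans (sumF-const N k) (*-comm N k))

  outDeg-wrapped : ∀ i → outDeg wrapped i ≡ suc (toℕ i) + k ∸ N
  outDeg-wrapped i = trans (count-cong {N} (λ j → cong₂ _∧_ (x<N+y (toℕ j)) (+-<ᵇ N (toℕ j) (suc x + k))))
                           (countBelow-between N 0 (suc x + k ∸ N) (m≤n+o⇒m∸n≤o (suc x + k) N (+-mono-≤ (toℕ<n i) (<⇒≤ k<N))))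
    where
    x = toℕ i
    x<N+y : ∀ y → (x <ᵇ N + y) ≡ true
    x<N+y y = Equivalence.to T-≡ (<⇒<ᵇ (≤-trans (toℕ<n i) (m≤m+n N y)))

  size-wrapped : size wrapped ≡ triangle k
  size-wrapped = trans (sumF-cong outDeg-wrapped)
    (subst (λ M → sumBelow M (λ x → suc x + k ∸ M) ≡ triangle k) (m∸n+n≡m k<N) (sumBelow-overflow (N ∸ suc k) k))

  wrapped-isFAS : IsFAS circulant wrapped
  wrapped-isFAS = wrapped⊆circulantArc , acyclic-if-monotone toℕ (λ i j r → window⇒< (toℕ i) (toℕ j) (∨-∧-not (forward i j) _ r))
    where
    wrapped⊆circulantArc : ∀ i j → wrapped i j ≡ true → circulantArc i j ≡ true
    wrapped⊆circulantArc i j w = trans (cong (forward i j ∨_) w) (∨-zeroʳ (forward i j))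

  circulant-β : IsBeta circulant (triangle k)
  circulant-β = (wrapped , wrapped-isFAS , size-wrapped) ,
    λ F F-fas → triangle≤size-fas circulantArc F circulantArc-irreflexive (proj₂ F-fas) k (<⇒≤ k<N)
                  (λ v → ≤-reflexive (sym (inDeg-circulant v)))

β-formula : ∀ N k → 2 * (N * N) * triangle k ≡ k * N * (k * N) + k * N * N
β-formula N k = begin
  2 * (N * N) * triangle k        ≡⟨ reorder N (triangle k) ⟩
  N * N * (2 * triangle k)        ≡⟨ cong (N * N *_) (double-triangle k) ⟩
  N * N * (k * suc k)             ≡⟨ expand N k ⟩
  k * N * (k * N) + k * N * N     ∎
  where
  open ≡-Reasoning
  reorder : ∀ N t → 2 * (N * N) * t ≡ N * N * (2 * t)
  reorder = solve-∀
  expand : ∀ N k → N * N * (k * suc k) ≡ k * N * (k * N) + k * N * N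
  expand = solve-∀

proposition1p2 : (m n : ℕ) → 0 < m → 0 < n → n ∣ m → m ≤ n * (n ∸ 1) →
    Σ (Digraph n) λ G → Eulerian G × size (arc G) ≡ m ×
      Σ ℕ λ b → IsBeta G b × 2 * (n * n) * b ≡ m * m + m * n
proposition1p2 m (suc n) _ _ (divides k refl) m≤n[n-1] =
  circulant , circulant-eulerian , size-circulant , triangle k , circulant-β , β-formula (suc n) k
  where
  k<N : k < suc n
  k<N = s≤s (*-cancelʳ-≤ k n (suc n) (subst (k * suc n ≤_) (*-comm (suc n) n) m≤n[n-1]))
  open Circulant (suc n) k k<N
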